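{- Let $k,\ell\ge0$ be integers. (i) If $k$ and $\ell$ are not both odd, then $h(k+\ell)\le h(k)+h(\ell)$. If equality holds, then $\mathcal{S}(k)\cap\mathcal{S}(\ell)$ is empty or contains only powers of $2$ with even exponent; if moreover $2^a\in\mathcal{S}(k)\cap\mathcal{S}(\ell)$ then $2^{a+1}\notin\mathcal{S}(k)\cup\mathcal{S}(\ell)$; and $$n_5(k+\ell)=n_5(k)+n_5(\ell)-\sum_{2^a\in\mathcal{S}(k)\cap\mathcal{S}(\ell)}2^{a/2}.$$ (ii) If $k$ and $\ell$ are both odd, then $h(k+\ell)\le h(k)+h(\ell)+1$. If equality holds, then $k\equiv\ell\equiv1\pmod 4$, $\mathcal{S}(k)\cap\mathcal{S}(\ell)$ is empty or contains only powers of $2$ with even exponent, $2^a\in\mathcal{S}(k)\cap\mathcal{S}(\ell)$ implies $2^{a+1}\notin\mathcal{S}(k)\cup\mathcal{S}(\ell)$, and $$n_5(k+\ell)=n_5(k)+n_5(\ell)-\sum_{2^a\in\mathcal{S}(k)\cap\mathcal{S}(\ell)}2^{a/2}.$$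
   Context: For an integer $k\ge0$ with binary expansion $k=\sum_{i\ge0}\beta_i2^i$ ($\beta_i\in\{0,1\}$), the support of $k$ is $\mathcal{S}(k)=\{2^i: i\ge1,\ \beta_i\ne0\}$ (it never contains $1$). Put $n_3(k)=\sum_{i\text{ odd}}\beta_i2^{(i-1)/2}$, $n_5(k)=\sum_{i\ge2,\ i\text{ even}}\beta_i2^{(i-2)/2}$ and $h(k)=n_3(k)+n_5(k)=\sum_{i\ge1}\beta_i2^{\lfloor (i-1)/2\rfloor}$. -}

module Defs where

open import Data.Nat using (ℕ; zero; suc; _+_; _*_; _^_; _/_; _%_; _≤_; _∸_)
open import Data.Product using (_×_)
open import Relation.Nullary using (does)
open import Relation.Binary.PropositionalEquality using (_≡_)

sumBelow : ℕ → (ℕ → ℕ) → ℕ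
sumBelow zero    f = 0
sumBelow (suc n) f = sumBelow n f + f n

bit : ℕ → ℕ → ℕ
bit k zero    = k % 2
bit k (suc i) = bit (k / 2) i

-- 2^a ∈ S(k): a ≥ 1 and β_a(k) = 1  (S(k) never contains 1 = 2^0)
InS : ℕ → ℕ → Set
InS k a = (1 ≤ a) × (bit k a ≡ 1)

Odd : ℕ → Set
Odd k = k % 2 ≡ 1

-- All sums below range over i < suc k; β_i(k) = 0 for i ≥ k since 2^i > i,
-- so this is the full (finite) sum over all i.

n3 : ℕ → ℕ
n3 k = sumBelow (suc k) λ i → (i % 2) * bit k i * 2 ^ (i / 2)

n5 : ℕ → ℕ
n5 k = sumBelow (suc k) term
  where
  term : ℕ → ℕ
  term zero          = 0
  term (suc zero)    = 0
  term (suc (suc j)) = (1 ∸ j % 2) * bit k (suc (suc j)) * 2 ^ (j / 2)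

h : ℕ → ℕ
h k = n3 k + n5 k

both : ℕ → ℕ → ℕ → ℕ
both k ℓ a = bit k a * bit ℓ a

-- Σ_{2^a ∈ S(k) ∩ S(ℓ)} 2^{a/2}  (a ranges over 1 ≤ a ≤ k + ℓ, enough since
-- bits of k vanish from index k on). For odd a, ⌊a/2⌋ is used, but the
-- statement only uses this sum when every such a is even.
commonSum : ℕ → ℕ → ℕ
commonSum k ℓ = sumBelow (suc (k + ℓ)) term
  where
  term : ℕ → ℕ
  term zero    = 0
  term (suc a) = both k ℓ (suc a) * 2 ^ (suc a / 2)

{-# OPTIONS --safe #-}
module Submission where

-- Let c_i be the carry into bit i when k and ℓ are added in binary. Multiplying the full-adder
-- identity β_i(k+ℓ) + 2 c_{i+1} = β_i(k) + β_i(ℓ) + c_i by the weight of bit i in h and summing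
-- over i gives
--   h(k+ℓ) + Σ_{i odd} 2^{(i-1)/2} c_{i+1} = h(k) + h(ℓ) + c_1,
-- where c_1 = 1 exactly when k and ℓ are both odd. Hence the bounds, and equality means that no
-- carry leaves an odd position. Then a common bit can only sit at an even position a, its carry
-- must die at a + 1, and the carries out of even positions are exactly the common bits, which
-- turns the same weighted sum for the n_5-weights into the formula for n_5(k+ℓ). For odd k and ℓ
-- the carry c_1 = 1 must die at position 1, so β_1(k) = β_1(ℓ) = 0.

open import Defs
open import Data.Nat
open import Data.Nat.Properties
open import Data.Nat.DivMod
open import Data.Nat.Divisibility using (divides)
open import Data.Nat.Tactic.RingSolver using (solve-∀)
open import Data.Product using (_×_; _,_; proj₂)
open import Data.Sum using (_⊎_; inj₁; inj₂)
import Data.Sum as Sum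
open import Function using (_∘_)
open import Relation.Nullary using (¬_; yes; no; contradiction)
open import Relation.Binary.PropositionalEquality
open ≡-Reasoning

sumBelow-cong : ∀ n {f g : ℕ → ℕ} → (∀ i → f i ≡ g i) → sumBelow n f ≡ sumBelow n g
sumBelow-cong zero    f≡g = refl
sumBelow-cong (suc n) f≡g = cong₂ _+_ (sumBelow-cong n f≡g) (f≡g n)

sumBelow-+ : ∀ n (f g : ℕ → ℕ) → sumBelow n (λ i → f i + g i) ≡ sumBelow n f + sumBelow n g
sumBelow-+ zero    f g = refl
sumBelow-+ (suc n) f g = trans (cong (_+ (f n + g n)) (sumBelow-+ n f g)) (swap (sumBelow n f) _ _ _)
  where
  swap : ∀ a b c d → a + b + (c + d) ≡ a + c + (b + d)
  swap = solve-∀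

sumBelow-+-cong : ∀ n {f g f′ g′ : ℕ → ℕ} → (∀ i → f i + g i ≡ f′ i + g′ i) →
                  sumBelow n f + sumBelow n g ≡ sumBelow n f′ + sumBelow n g′
sumBelow-+-cong n {f} {g} {f′} {g′} eq = begin
  sumBelow n f + sumBelow n g       ≡⟨ sumBelow-+ n f g ⟨
  sumBelow n (λ i → f i + g i)      ≡⟨ sumBelow-cong n eq ⟩
  sumBelow n (λ i → f′ i + g′ i)    ≡⟨ sumBelow-+ n f′ g′ ⟩
  sumBelow n f′ + sumBelow n g′     ∎

sumBelow-zero : ∀ n {f : ℕ → ℕ} → (∀ i → f i ≡ 0) → sumBelow n f ≡ 0
sumBelow-zero zero    f≡0 = refl
sumBelow-zero (suc n) f≡0 = cong₂ _+_ (sumBelow-zero n f≡0) (f≡0 n)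

sumBelow-suc : ∀ n (f : ℕ → ℕ) → sumBelow (suc n) f ≡ f 0 + sumBelow n (f ∘ suc)
sumBelow-suc zero    f = +-comm 0 (f 0)
sumBelow-suc (suc n) f = trans (cong (_+ f (suc n)) (sumBelow-suc n f)) (+-assoc (f 0) _ _)

sumBelow-shift : ∀ n (f : ℕ → ℕ) → f 0 ≡ 0 → f n ≡ 0 → sumBelow n f ≡ sumBelow n (f ∘ suc)
sumBelow-shift zero    f f0 fn = refl
sumBelow-shift (suc n) f f0 fn = begin
  sumBelow (suc n) f                 ≡⟨ sumBelow-suc n f ⟩
  f 0 + sumBelow n (f ∘ suc)         ≡⟨ cong (_+ sumBelow n (f ∘ suc)) f0 ⟩
  sumBelow n (f ∘ suc)               ≡⟨ +-identityʳ _ ⟨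
  sumBelow n (f ∘ suc) + 0           ≡⟨ cong (sumBelow n (f ∘ suc) +_) fn ⟨
  sumBelow (suc n) (f ∘ suc)         ∎

sumBelow-extend : ∀ {n} m (f : ℕ → ℕ) → n ≤ m → (∀ i → n ≤ i → f i ≡ 0) → sumBelow m f ≡ sumBelow n f
sumBelow-extend zero    f z≤n f≡0 = refl
sumBelow-extend (suc m) f n≤1+m f≡0 with m≤n⇒m<n∨m≡n n≤1+m
... | inj₂ refl = refl
... | inj₁ n<1+m = trans (cong₂ _+_ (sumBelow-extend m f n≤m f≡0) (f≡0 m n≤m)) (+-identityʳ _)
  where n≤m = ≤-pred n<1+m

sumBelow≡0⇒≡0 : ∀ n (f : ℕ → ℕ) → sumBelow n f ≡ 0 → ∀ {i} → i < n → f i ≡ 0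
sumBelow≡0⇒≡0 (suc n) f sum≡0 i<1+n with m≤n⇒m<n∨m≡n (≤-pred i<1+n)
... | inj₁ i<n  = sumBelow≡0⇒≡0 n f (m+n≡0⇒m≡0 _ sum≡0) i<n
... | inj₂ refl = m+n≡0⇒n≡0 _ sum≡0

m%2≡0∨m%2≡1 : ∀ m → m % 2 ≡ 0 ⊎ m % 2 ≡ 1
m%2≡0∨m%2≡1 m = n≤1⇒n≡0∨n≡1 (≤-pred (m%n<n m 2))

even⇒suc-odd : ∀ i → i % 2 ≡ 0 → suc i % 2 ≡ 1
even⇒suc-odd zero          _    = refl
even⇒suc-odd (suc zero)    ()
even⇒suc-odd (suc (suc i)) even = even⇒suc-odd i even

[x+y+0]/2≡x*y : ∀ {x y} → x ≤ 1 → y ≤ 1 → (x + y + 0) / 2 ≡ x * y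
[x+y+0]/2≡x*y z≤n       z≤n       = refl
[x+y+0]/2≡x*y z≤n       (s≤s z≤n) = refl
[x+y+0]/2≡x*y (s≤s z≤n) z≤n       = refl
[x+y+0]/2≡x*y (s≤s z≤n) (s≤s z≤n) = refl

[2+i]/2≡1+i/2 : ∀ i → (2 + i) / 2 ≡ suc (i / 2)
[2+i]/2≡1+i/2 i = m/n≡1+[m∸n]/n {2 + i} {2} (s≤s (s≤s z≤n))

bitsFrom : ℕ → ℕ → ℕ
bitsFrom zero    x = x
bitsFrom (suc i) x = bitsFrom i (x / 2)

bit≡bitsFrom%2 : ∀ x i → bit x i ≡ bitsFrom i x % 2
bit≡bitsFrom%2 x zero    = refl
bit≡bitsFrom%2 x (suc i) = bit≡bitsFrom%2 (x / 2) i

bitsFrom-suc : ∀ i x → bitsFrom (suc i) x ≡ bitsFrom i x / 2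
bitsFrom-suc zero    x = refl
bitsFrom-suc (suc i) x = bitsFrom-suc i (x / 2)

bitsFrom-split : ∀ i x → bitsFrom i x ≡ bit x i + 2 * bitsFrom (suc i) x
bitsFrom-split i x = begin
  bitsFrom i x                                    ≡⟨ m≡m%n+[m/n]*n (bitsFrom i x) 2 ⟩
  bitsFrom i x % 2 + bitsFrom i x / 2 * 2         ≡⟨ cong₂ _+_ (sym (bit≡bitsFrom%2 x i)) (*-comm (bitsFrom i x / 2) 2) ⟩
  bit x i + 2 * (bitsFrom i x / 2)                ≡⟨ cong (λ y → bit x i + 2 * y) (bitsFrom-suc i x) ⟨
  bit x i + 2 * bitsFrom (suc i) x                ∎

bit≤1 : ∀ x i → bit x i ≤ 1
bit≤1 x i = subst (_≤ 1) (sym (bit≡bitsFrom%2 x i)) (≤-pred (m%n<n (bitsFrom i x) 2))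

bit-cases : ∀ x i → bit x i ≡ 0 ⊎ bit x i ≡ 1
bit-cases x i = n≤1⇒n≡0∨n≡1 (bit≤1 x i)

x≤1+i⇒x/2≤i : ∀ {x i} → x ≤ suc i → x / 2 ≤ i
x≤1+i⇒x/2≤i {zero}  _     = z≤n
x≤1+i⇒x/2≤i {suc x} x≤1+i = ≤-pred (≤-trans (m/n<m (suc x) 2 (s≤s (s≤s z≤n))) x≤1+i)

bitsFrom-vanishes : ∀ {x} i → x ≤ i → bitsFrom i x ≡ 0
bitsFrom-vanishes zero    x≤0   = n≤0⇒n≡0 x≤0
bitsFrom-vanishes (suc i) x≤1+i = bitsFrom-vanishes i (x≤1+i⇒x/2≤i x≤1+i)

bit-vanishes : ∀ {x} i → x ≤ i → bit x i ≡ 0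
bit-vanishes {x} i x≤i = trans (bit≡bitsFrom%2 x i) (cong (_% 2) (bitsFrom-vanishes i x≤i))

bits⇒≡1mod4 : ∀ {x} → bit x 0 ≡ 1 → bit x 1 ≡ 0 → x % 4 ≡ 1
bits⇒≡1mod4 {x} b₀ b₁ = trans (cong (_% 4) x≡1+q*4) ([m+kn]%n≡m%n 1 q 4)
  where
  q = bitsFrom 2 x
  regroup : ∀ q → 1 + 2 * (0 + 2 * q) ≡ 1 + q * 4
  regroup = solve-∀
  x≡1+q*4 : x ≡ 1 + q * 4
  x≡1+q*4 = begin
    x                                     ≡⟨ bitsFrom-split 0 x ⟩
    bit x 0 + 2 * bitsFrom 1 x            ≡⟨ cong (λ y → bit x 0 + 2 * y) (bitsFrom-split 1 x) ⟩
    bit x 0 + 2 * (bit x 1 + 2 * q)       ≡⟨ cong₂ (λ a b → a + 2 * (b + 2 * q)) b₀ b₁ ⟩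
    1 + 2 * (0 + 2 * q)                   ≡⟨ regroup q ⟩
    1 + q * 4                             ∎

carry : ℕ → ℕ → ℕ → ℕ
carry k l zero    = 0
carry k l (suc i) = (bit k i + bit l i + carry k l i) / 2

module _ (k l : ℕ) where

  carry≤1 : ∀ i → carry k l i ≤ 1
  carry≤1 zero    = z≤n
  carry≤1 (suc i) = /-monoˡ-≤ 2 (+-mono-≤ (+-mono-≤ (bit≤1 k i) (bit≤1 l i)) (carry≤1 i))

  bitsFrom-+ : ∀ i → bitsFrom i (k + l) ≡ bitsFrom i k + bitsFrom i l + carry k l i
  bitsFrom-+ zero    = sym (+-identityʳ _)
  bitsFrom-+ (suc i) = begin
    bitsFrom (suc i) (k + l)                  ≡⟨ bitsFrom-suc i (k + l) ⟩
    bitsFrom i (k + l) / 2                    ≡⟨ cong (_/ 2) (bitsFrom-+ i) ⟩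
    (bitsFrom i k + bitsFrom i l + c i) / 2   ≡⟨ cong (_/ 2) (cong₂ (λ a b → a + b + c i) (bitsFrom-split i k) (bitsFrom-split i l)) ⟩
    (bit k i + 2 * K + (bit l i + 2 * L) + c i) / 2
                                              ≡⟨ cong (_/ 2) (regroup (bit k i) (bit l i) (c i) K L) ⟩
    (bit k i + bit l i + c i + (K + L) * 2) / 2
                                              ≡⟨ +-distrib-/-∣ʳ (bit k i + bit l i + c i) (divides (K + L) refl) ⟩
    c (suc i) + (K + L) * 2 / 2               ≡⟨ cong (c (suc i) +_) (m*n/n≡m (K + L) 2) ⟩
    c (suc i) + (K + L)                       ≡⟨ +-comm (c (suc i)) (K + L) ⟩
    K + L + c (suc i)                         ∎
    where
    c = carry k l
    K = bitsFrom (suc i) k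
    L = bitsFrom (suc i) l
    regroup : ∀ a b z x y → a + 2 * x + (b + 2 * y) + z ≡ a + b + z + (x + y) * 2
    regroup = solve-∀

  bit-+ : ∀ i → bit (k + l) i + 2 * carry k l (suc i) ≡ bit k i + bit l i + carry k l i
  bit-+ i = +-cancelʳ-≡ (2 * (K + L)) _ _ (begin
    bit (k + l) i + 2 * c (suc i) + 2 * (K + L)   ≡⟨ regroup₁ (bit (k + l) i) (c (suc i)) K L ⟩
    bit (k + l) i + 2 * (K + L + c (suc i))       ≡⟨ cong (λ y → bit (k + l) i + 2 * y) (bitsFrom-+ (suc i)) ⟨
    bit (k + l) i + 2 * bitsFrom (suc i) (k + l)  ≡⟨ bitsFrom-split i (k + l) ⟨
    bitsFrom i (k + l)                            ≡⟨ bitsFrom-+ i ⟩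
    bitsFrom i k + bitsFrom i l + c i             ≡⟨ cong₂ (λ a b → a + b + c i) (bitsFrom-split i k) (bitsFrom-split i l) ⟩
    bit k i + 2 * K + (bit l i + 2 * L) + c i     ≡⟨ regroup₂ (bit k i) (bit l i) (c i) K L ⟩
    bit k i + bit l i + c i + 2 * (K + L)         ∎)
    where
    c = carry k l
    K = bitsFrom (suc i) k
    L = bitsFrom (suc i) l
    regroup₁ : ∀ b z x y → b + 2 * z + 2 * (x + y) ≡ b + 2 * (x + y + z)
    regroup₁ = solve-∀
    regroup₂ : ∀ a b z x y → a + 2 * x + (b + 2 * y) + z ≡ a + b + z + 2 * (x + y)
    regroup₂ = solve-∀

  carry-vanishes : ∀ i → k + l ≤ i → carry k l i ≡ 0
  carry-vanishes i k+l≤i =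
    m+n≡0⇒n≡0 (bitsFrom i k + bitsFrom i l) (trans (sym (bitsFrom-+ i)) (bitsFrom-vanishes i k+l≤i))

  2≤inputs⇒carry≡1 : ∀ i → 2 ≤ bit k i + bit l i + carry k l i → carry k l (suc i) ≡ 1
  2≤inputs⇒carry≡1 i 2≤sum = ≤-antisym (carry≤1 (suc i)) (/-monoˡ-≤ 2 2≤sum)

  bits⇒carry : ∀ i → bit k i ≡ 1 → bit l i ≡ 1 → carry k l (suc i) ≡ 1
  bits⇒carry i bk bl = 2≤inputs⇒carry≡1 i (subst₂ (λ x y → 2 ≤ x + y + carry k l i) (sym bk) (sym bl) (m≤m+n 2 _))

  carry-propagates : ∀ i → carry k l i ≡ 1 → bit k i ≡ 1 ⊎ bit l i ≡ 1 → carry k l (suc i) ≡ 1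
  carry-propagates i c≡1 (inj₁ bk) =
    2≤inputs⇒carry≡1 i (subst₂ (λ x z → 2 ≤ x + bit l i + z) (sym bk) (sym c≡1) (+-monoˡ-≤ 1 (+-monoʳ-≤ 1 (z≤n {bit l i}))))
  carry-propagates i c≡1 (inj₂ bl) =
    2≤inputs⇒carry≡1 i (subst₂ (λ y z → 2 ≤ bit k i + y + z) (sym bl) (sym c≡1) (+-monoˡ-≤ 1 (+-monoˡ-≤ 1 (z≤n {bit k i}))))

  carry≡0⇒both≡0 : ∀ i → carry k l (suc i) ≡ 0 → both k l i ≡ 0
  carry≡0⇒both≡0 i c≡0 with bit-cases k i | bit-cases l i
  ... | inj₁ bk | _       = cong (_* bit l i) bk
  ... | inj₂ _  | inj₁ bl = trans (cong (bit k i *_) bl) (*-zeroʳ (bit k i))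
  ... | inj₂ bk | inj₂ bl = contradiction (trans (sym c≡0) (bits⇒carry i bk bl)) 0≢1+n

  carry≡both : ∀ i → carry k l i ≡ 0 → carry k l (suc i) ≡ both k l i
  carry≡both i c≡0 =
    trans (cong (λ z → (bit k i + bit l i + z) / 2) c≡0) ([x+y+0]/2≡x*y (bit≤1 k i) (bit≤1 l i))

n3Weight : ℕ → ℕ
n3Weight i = i % 2 * 2 ^ (i / 2)

n5Weight : ℕ → ℕ
n5Weight zero          = 0
n5Weight (suc zero)    = 0
n5Weight (suc (suc j)) = (1 ∸ j % 2) * 2 ^ (j / 2)

hWeight : ℕ → ℕ
hWeight i = n3Weight i + n5Weight i

private
  a*[2*b]≡2*[a*b] : ∀ a b → a * (2 * b) ≡ 2 * (a * b)
  a*[2*b]≡2*[a*b] = solve-∀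

n3Weight-+2 : ∀ i → n3Weight (2 + i) ≡ 2 * n3Weight i
n3Weight-+2 i = trans (cong (λ e → i % 2 * 2 ^ e) ([2+i]/2≡1+i/2 i)) (a*[2*b]≡2*[a*b] (i % 2) _)

n5Weight-+2 : ∀ i → n5Weight (3 + i) ≡ 2 * n5Weight (1 + i)
n5Weight-+2 zero    = refl
n5Weight-+2 (suc j) = trans (cong (λ e → (1 ∸ j % 2) * 2 ^ e) ([2+i]/2≡1+i/2 j)) (a*[2*b]≡2*[a*b] (1 ∸ j % 2) _)

hWeight-+2 : ∀ i → hWeight (3 + i) ≡ 2 * hWeight (1 + i)
hWeight-+2 i = trans (cong₂ _+_ (n3Weight-+2 (1 + i)) (n5Weight-+2 i)) (sym (*-distribˡ-+ 2 (n3Weight (1 + i)) (n5Weight (1 + i))))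

-- 1 ∸ i is the indicator of i ≡ 0.
hWeight-suc : ∀ i → hWeight (suc i) + n3Weight i ≡ 2 * hWeight i + (1 ∸ i)
hWeight-suc 0 = refl
hWeight-suc 1 = refl
hWeight-suc 2 = refl
hWeight-suc (suc (suc (suc i))) = begin
  hWeight (4 + i) + n3Weight (3 + i)             ≡⟨ cong₂ _+_ (hWeight-+2 (1 + i)) (n3Weight-+2 (1 + i)) ⟩
  2 * hWeight (2 + i) + 2 * n3Weight (1 + i)     ≡⟨ *-distribˡ-+ 2 (hWeight (2 + i)) _ ⟨
  2 * (hWeight (2 + i) + n3Weight (1 + i))       ≡⟨ cong (2 *_) (hWeight-suc (suc i)) ⟩
  2 * (2 * hWeight (1 + i) + (0 ∸ i))            ≡⟨ cong (λ z → 2 * (2 * hWeight (1 + i) + z)) (0∸n≡0 i) ⟩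
  2 * (2 * hWeight (1 + i) + 0)                  ≡⟨ cong (2 *_) (+-identityʳ (2 * hWeight (1 + i))) ⟩
  2 * (2 * hWeight (1 + i))                      ≡⟨ cong (2 *_) (hWeight-+2 i) ⟨
  2 * hWeight (3 + i)                            ≡⟨ +-identityʳ _ ⟨
  2 * hWeight (3 + i) + 0                        ∎

sumBelow-[1∸i]*f≡f0 : ∀ n (f : ℕ → ℕ) → sumBelow (suc n) (λ i → (1 ∸ i) * f i) ≡ f 0
sumBelow-[1∸i]*f≡f0 n f = begin
  sumBelow (suc n) (λ i → (1 ∸ i) * f i)   ≡⟨ sumBelow-suc n _ ⟩
  1 * f 0 + sumBelow n (λ i → (0 ∸ i) * f (suc i))
                                           ≡⟨ cong₂ _+_ (*-identityˡ (f 0)) (sumBelow-zero n (λ i → cong (_* f (suc i)) (0∸n≡0 i))) ⟩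
  f 0 + 0                                  ≡⟨ +-identityʳ (f 0) ⟩
  f 0                                      ∎

hWeight-sum : ∀ n (f : ℕ → ℕ) →
              sumBelow (suc n) (λ i → hWeight (suc i) * f i) + sumBelow (suc n) (λ i → n3Weight i * f i)
              ≡ sumBelow (suc n) (λ i → 2 * (hWeight i * f i)) + f 0
hWeight-sum n f = trans (sumBelow-+-cong (suc n) pointwise)
                        (cong (sumBelow (suc n) (λ i → 2 * (hWeight i * f i)) +_) (sumBelow-[1∸i]*f≡f0 n f))
  where
  pointwise : ∀ i → hWeight (suc i) * f i + n3Weight i * f i ≡ 2 * (hWeight i * f i) + (1 ∸ i) * f i
  pointwise i = begin
    hWeight (suc i) * f i + n3Weight i * f i   ≡⟨ *-distribʳ-+ (f i) (hWeight (suc i)) _ ⟨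
    (hWeight (suc i) + n3Weight i) * f i       ≡⟨ cong (_* f i) (hWeight-suc i) ⟩
    (2 * hWeight i + (1 ∸ i)) * f i            ≡⟨ *-distribʳ-+ (f i) (2 * hWeight i) _ ⟩
    2 * hWeight i * f i + (1 ∸ i) * f i        ≡⟨ cong (_+ (1 ∸ i) * f i) (*-assoc 2 (hWeight i) (f i)) ⟩
    2 * (hWeight i * f i) + (1 ∸ i) * f i      ∎

digitSum : ℕ → (ℕ → ℕ) → ℕ → ℕ
digitSum n u x = sumBelow n (λ i → u i * bit x i)

digitSum-extend : ∀ {n} (u : ℕ → ℕ) x → x < n → digitSum n u x ≡ digitSum (suc x) u x
digitSum-extend {n} u x x<n = sumBelow-extend n (λ i → u i * bit x i) x<n
  (λ i x<i → trans (cong (u i *_) (bit-vanishes i (<⇒≤ x<i))) (*-zeroʳ (u i)))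

private
  ab*c≡ac*b : ∀ a b c → a * b * c ≡ a * c * b
  ab*c≡ac*b = solve-∀

n3≡digitSum : ∀ {n} x → x < n → n3 x ≡ digitSum n n3Weight x
n3≡digitSum x x<n = trans (sumBelow-cong (suc x) (λ i → ab*c≡ac*b (i % 2) (bit x i) (2 ^ (i / 2))))
                          (sym (digitSum-extend n3Weight x x<n))

n5≡digitSum : ∀ {n} x → x < n → n5 x ≡ digitSum n n5Weight x
n5≡digitSum x x<n = trans (sumBelow-cong (suc x) λ { zero          → refl
                                                   ; (suc zero)    → refl
                                                   ; (suc (suc j)) → ab*c≡ac*b (1 ∸ j % 2) (bit x (2 + j)) (2 ^ (j / 2)) })
                          (sym (digitSum-extend n5Weight x x<n))

h≡digitSum : ∀ {n} x → x < n → h x ≡ digitSum n hWeight x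
h≡digitSum {n} x x<n = begin
  n3 x + n5 x                                    ≡⟨ cong₂ _+_ (n3≡digitSum x x<n) (n5≡digitSum x x<n) ⟩
  digitSum n n3Weight x + digitSum n n5Weight x  ≡⟨ sumBelow-+ n _ _ ⟨
  sumBelow n (λ i → n3Weight i * bit x i + n5Weight i * bit x i)
                                                 ≡⟨ sumBelow-cong n (λ i → *-distribʳ-+ (bit x i) (n3Weight i) _) ⟨
  digitSum n hWeight x                           ∎

digitSum-+ : ∀ k l n (u : ℕ → ℕ) →
             digitSum n u (k + l) + sumBelow n (λ i → 2 * (u i * carry k l (suc i)))
             ≡ digitSum n u k + digitSum n u l + sumBelow n (λ i → u i * carry k l i)
digitSum-+ k l n u = trans (sumBelow-+-cong n pointwise)
                           (cong (_+ sumBelow n (λ i → u i * carry k l i)) (sumBelow-+ n _ _))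
  where
  distribute₂ : ∀ a x y → a * x + 2 * (a * y) ≡ a * (x + 2 * y)
  distribute₂ = solve-∀
  distribute₃ : ∀ a x y z → a * (x + y + z) ≡ a * x + a * y + a * z
  distribute₃ = solve-∀
  pointwise : ∀ i → u i * bit (k + l) i + 2 * (u i * carry k l (suc i))
                    ≡ (u i * bit k i + u i * bit l i) + u i * carry k l i
  pointwise i = begin
    u i * bit (k + l) i + 2 * (u i * carry k l (suc i))   ≡⟨ distribute₂ (u i) _ _ ⟩
    u i * (bit (k + l) i + 2 * carry k l (suc i))         ≡⟨ cong (u i *_) (bit-+ k l i) ⟩
    u i * (bit k i + bit l i + carry k l i)               ≡⟨ distribute₃ (u i) _ _ _ ⟩
    u i * bit k i + u i * bit l i + u i * carry k l i     ∎

oddCarries : ℕ → ℕ → ℕ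
oddCarries k l = sumBelow (suc (k + l)) (λ i → n3Weight i * carry k l (suc i))

h-+ : ∀ k l → h (k + l) + oddCarries k l ≡ h k + h l + carry k l 1
h-+ k l = +-cancelʳ-≡ A _ _ (begin
  h (k + l) + oddCarries k l + A     ≡⟨ swap (h (k + l)) _ A ⟩
  h (k + l) + A + oddCarries k l     ≡⟨ cong (_+ oddCarries k l) adder ⟩
  h k + h l + B + oddCarries k l     ≡⟨ +-assoc (h k + h l) B _ ⟩
  h k + h l + (B + oddCarries k l)   ≡⟨ cong (h k + h l +_) (hWeight-sum (k + l) (c ∘ suc)) ⟩
  h k + h l + (A + c 1)              ≡⟨ swap′ (h k + h l) A (c 1) ⟩
  h k + h l + c 1 + A                ∎)
  where
  N = suc (k + l)
  c = carry k l
  A = sumBelow N (λ i → 2 * (hWeight i * c (suc i)))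
  B = sumBelow N (λ i → hWeight (suc i) * c (suc i))
  swap : ∀ x y z → x + y + z ≡ x + z + y
  swap = solve-∀
  swap′ : ∀ x y z → x + (y + z) ≡ x + z + y
  swap′ = solve-∀
  lastCarry≡0 : hWeight N * c N ≡ 0
  lastCarry≡0 = trans (cong (hWeight N *_) (carry-vanishes k l N (n≤1+n _))) (*-zeroʳ (hWeight N))
  adder : h (k + l) + A ≡ h k + h l + B
  adder = begin
    h (k + l) + A                                                 ≡⟨ cong (_+ A) (h≡digitSum (k + l) ≤-refl) ⟩
    digitSum N hWeight (k + l) + A                                ≡⟨ digitSum-+ k l N hWeight ⟩
    digitSum N hWeight k + digitSum N hWeight l + sumBelow N (λ i → hWeight i * c i)
      ≡⟨ cong₂ _+_ (cong₂ _+_ (sym (h≡digitSum k (s≤s (m≤m+n k l)))) (sym (h≡digitSum l (s≤s (m≤n+m l k)))))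
                   (sumBelow-shift N _ refl lastCarry≡0) ⟩
    h k + h l + B                                                 ∎

h-+-≤ : ∀ k l {c} → carry k l 1 ≡ c → h (k + l) ≤ h k + h l + c
h-+-≤ k l c₁≡c = ≤-trans (m≤m+n _ (oddCarries k l)) (≤-reflexive (trans (h-+ k l) (cong (h k + h l +_) c₁≡c)))

NoOddCarry : ℕ → ℕ → Set
NoOddCarry k l = ∀ i → i % 2 ≡ 1 → carry k l (suc i) ≡ 0

n3Weight-odd : ∀ {i} → i % 2 ≡ 1 → n3Weight i ≡ 2 ^ (i / 2)
n3Weight-odd {i} odd = trans (cong (_* 2 ^ (i / 2)) odd) (*-identityˡ _)

oddCarries≡0⇒noOddCarry : ∀ k l → oddCarries k l ≡ 0 → NoOddCarry k l
oddCarries≡0⇒noOddCarry k l sum≡0 i odd with i <? suc (k + l)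
... | no  i≮N = carry-vanishes k l (suc i) (≤-trans (<⇒≤ (≮⇒≥ i≮N)) (n≤1+n i))
... | yes i<N with m*n≡0⇒m≡0∨n≡0 (n3Weight i) (sumBelow≡0⇒≡0 _ _ sum≡0 i<N)
...   | inj₂ carry≡0  = carry≡0
...   | inj₁ weight≡0 = contradiction (trans (sym weight≡0) (n3Weight-odd {i} odd)) (<⇒≢ (m^n>0 2 (i / 2)))

h-+-≡⇒noOddCarry : ∀ k l {c} → carry k l 1 ≡ c → h (k + l) ≡ h k + h l + c → NoOddCarry k l
h-+-≡⇒noOddCarry k l {c} c₁≡c eq = oddCarries≡0⇒noOddCarry k l (+-cancelˡ-≡ (h (k + l)) _ 0 (begin
  h (k + l) + oddCarries k l    ≡⟨ h-+ k l ⟩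
  h k + h l + carry k l 1       ≡⟨ cong (h k + h l +_) c₁≡c ⟩
  h k + h l + c                 ≡⟨ eq ⟨
  h (k + l)                     ≡⟨ +-identityʳ _ ⟨
  h (k + l) + 0                 ∎))

module _ (k l : ℕ) (noCarry : NoOddCarry k l) where

  noOddCarry⇒common-even : ∀ a → InS k a → InS l a → a % 2 ≡ 0
  noOddCarry⇒common-even a (_ , ka) (_ , la) with m%2≡0∨m%2≡1 a
  ... | inj₁ even = even
  ... | inj₂ odd  = contradiction (trans (sym (noCarry a odd)) (bits⇒carry k l a ka la)) 0≢1+n

  noOddCarry⇒common-isolated : ∀ a → InS k a → InS l a → ¬ (InS k (suc a) ⊎ InS l (suc a))
  noOddCarry⇒common-isolated a inK inL next = 0≢1+n (begin
    0                         ≡⟨ noCarry (suc a) (even⇒suc-odd a (noOddCarry⇒common-even a inK inL)) ⟨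
    carry k l (2 + a)         ≡⟨ carry-propagates k l (suc a) (bits⇒carry k l a (proj₂ inK) (proj₂ inL)) (Sum.map proj₂ proj₂ next) ⟩
    1                         ∎)

  noOddCarry⇒≡1mod4 : Odd k → Odd l → k % 4 ≡ 1 × l % 4 ≡ 1
  noOddCarry⇒≡1mod4 oddK oddL = bits⇒≡1mod4 {k} oddK (secondBit≡0 k inj₁) , bits⇒≡1mod4 {l} oddL (secondBit≡0 l inj₂)
    where
    secondBit≡0 : ∀ x → (bit x 1 ≡ 1 → bit k 1 ≡ 1 ⊎ bit l 1 ≡ 1) → bit x 1 ≡ 0
    secondBit≡0 x isBitOfKOrL with bit-cases x 1
    ... | inj₁ b≡0 = b≡0
    ... | inj₂ b≡1 = contradiction
      (trans (sym (noCarry 1 refl)) (carry-propagates k l 1 (bits⇒carry k l 0 oddK oddL) (isBitOfKOrL b≡1))) 0≢1+n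

  noOddCarry⇒n5-+ : n5 (k + l) + commonSum k l ≡ n5 k + n5 l
  noOddCarry⇒n5-+ = begin
    n5 (k + l) + commonSum k l
      ≡⟨ cong₂ _+_ (n5≡digitSum (k + l) ≤-refl) (sumBelow-cong N λ { zero → refl ; (suc a) → sym (commonTerm a) }) ⟩
    digitSum N n5Weight (k + l) + sumBelow N (λ i → 2 * (n5Weight i * carry k l (suc i)))
      ≡⟨ digitSum-+ k l N n5Weight ⟩
    digitSum N n5Weight k + digitSum N n5Weight l + sumBelow N (λ i → n5Weight i * carry k l i)
      ≡⟨ cong (digitSum N n5Weight k + digitSum N n5Weight l +_) (sumBelow-zero N noCarryIn) ⟩
    digitSum N n5Weight k + digitSum N n5Weight l + 0
      ≡⟨ +-identityʳ _ ⟩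
    digitSum N n5Weight k + digitSum N n5Weight l
      ≡⟨ cong₂ _+_ (n5≡digitSum k (s≤s (m≤m+n k l))) (n5≡digitSum l (s≤s (m≤n+m l k))) ⟨
    n5 k + n5 l ∎
    where
    N = suc (k + l)
    -- n_5 weights live on even positions, whose incoming carry leaves an odd one.
    noCarryIn : ∀ i → n5Weight i * carry k l i ≡ 0
    noCarryIn zero          = refl
    noCarryIn (suc zero)    = refl
    noCarryIn (suc (suc j)) with m%2≡0∨m%2≡1 j
    ... | inj₁ even = trans (cong (n5Weight (2 + j) *_) (noCarry (suc j) (even⇒suc-odd j even))) (*-zeroʳ (n5Weight (2 + j)))
    ... | inj₂ odd  = cong (λ p → (1 ∸ p) * 2 ^ (j / 2) * carry k l (2 + j)) odd
    regroup : ∀ p b → 2 * (1 * p * b) ≡ b * (2 * p)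
    regroup = solve-∀
    commonTerm : ∀ a → 2 * (n5Weight (suc a) * carry k l (2 + a)) ≡ both k l (suc a) * 2 ^ (suc a / 2)
    commonTerm zero    = sym (cong (_* 1) (carry≡0⇒both≡0 k l 1 (noCarry 1 refl)))
    commonTerm (suc j) with m%2≡0∨m%2≡1 j
    ... | inj₂ odd  = trans (cong (λ p → 2 * ((1 ∸ p) * 2 ^ (j / 2) * carry k l (3 + j))) odd)
                            (sym (cong (_* 2 ^ ((2 + j) / 2)) (carry≡0⇒both≡0 k l (2 + j) (noCarry (2 + j) odd))))
    ... | inj₁ even = begin
      2 * ((1 ∸ j % 2) * 2 ^ (j / 2) * carry k l (3 + j))
        ≡⟨ cong₂ (λ p q → 2 * ((1 ∸ p) * 2 ^ (j / 2) * q)) even (carry≡both k l (2 + j) (noCarry (suc j) (even⇒suc-odd j even))) ⟩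
      2 * (1 * 2 ^ (j / 2) * both k l (2 + j))   ≡⟨ regroup (2 ^ (j / 2)) (both k l (2 + j)) ⟩
      both k l (2 + j) * (2 * 2 ^ (j / 2))       ≡⟨ cong (λ e → both k l (2 + j) * 2 ^ e) ([2+i]/2≡1+i/2 j) ⟨
      both k l (2 + j) * 2 ^ ((2 + j) / 2)       ∎

carry₁≡0 : ∀ k l → ¬ (Odd k × Odd l) → carry k l 1 ≡ 0
carry₁≡0 k l notBothOdd with m%2≡0∨m%2≡1 k | m%2≡0∨m%2≡1 l
... | inj₂ oddK | inj₂ oddL = contradiction (oddK , oddL) notBothOdd
... | inj₁ p    | inj₁ q    = cong₂ (λ x y → (x + y + 0) / 2) p q
... | inj₁ p    | inj₂ q    = cong₂ (λ x y → (x + y + 0) / 2) p q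
... | inj₂ p    | inj₁ q    = cong₂ (λ x y → (x + y + 0) / 2) p q

proposition4p2 : (k ℓ : ℕ) →
    (¬ (Odd k × Odd ℓ) →
      (h (k + ℓ) ≤ h k + h ℓ)
      × (h (k + ℓ) ≡ h k + h ℓ →
          ((a : ℕ) → InS k a → InS ℓ a → a % 2 ≡ 0)
          × ((a : ℕ) → InS k a → InS ℓ a → ¬ (InS k (suc a) ⊎ InS ℓ (suc a)))
          × (n5 (k + ℓ) + commonSum k ℓ ≡ n5 k + n5 ℓ)))
    × (Odd k × Odd ℓ →
      (h (k + ℓ) ≤ h k + h ℓ + 1)
      × (h (k + ℓ) ≡ h k + h ℓ + 1 →
          (k % 4 ≡ 1 × ℓ % 4 ≡ 1)
          × ((a : ℕ) → InS k a → InS ℓ a → a % 2 ≡ 0)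
          × ((a : ℕ) → InS k a → InS ℓ a → ¬ (InS k (suc a) ⊎ InS ℓ (suc a)))
          × (n5 (k + ℓ) + commonSum k ℓ ≡ n5 k + n5 ℓ)))
proposition4p2 k ℓ =
    (λ notBothOdd → let c₁≡0 = carry₁≡0 k ℓ notBothOdd in
        subst (h (k + ℓ) ≤_) (+-identityʳ _) (h-+-≤ k ℓ c₁≡0)
      , λ eq → equalityCase (h-+-≡⇒noOddCarry k ℓ c₁≡0 (trans eq (sym (+-identityʳ _)))))
  , (λ (oddK , oddℓ) → let c₁≡1 = bits⇒carry k ℓ 0 oddK oddℓ in
        h-+-≤ k ℓ c₁≡1
      , λ eq → let noCarry = h-+-≡⇒noOddCarry k ℓ c₁≡1 eq in
          noOddCarry⇒≡1mod4 k ℓ noCarry oddK oddℓ , equalityCase noCarry)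
  where
  equalityCase : NoOddCarry k ℓ →
                 ((a : ℕ) → InS k a → InS ℓ a → a % 2 ≡ 0)
                 × ((a : ℕ) → InS k a → InS ℓ a → ¬ (InS k (suc a) ⊎ InS ℓ (suc a)))
                 × (n5 (k + ℓ) + commonSum k ℓ ≡ n5 k + n5 ℓ)
  equalityCase noCarry = noOddCarry⇒common-even k ℓ noCarry
                       , noOddCarry⇒common-isolated k ℓ noCarry
                       , noOddCarry⇒n5-+ k ℓ noCarry
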